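{- Let $t$ be a BESsy structure graph. Then for all environments $\eta$: $[\![\varphi(t)]\!]([\![\mathrm{BES}(t)]\!]\eta) = [\![\varphi(\mathrm{norm}(t))]\!]([\![\mathrm{BES}(\mathrm{norm}(t))]\!]\eta)$.
   Context: A structure graph $\langle T,t,\to,d,r,\nearrow\rangle$ has vertices, root $t$, edges $\to$, partial decoration $d:T\to\{\blacktriangle,\blacktriangledown,\top,\bot\}$, partial rank $r:T\to\mathbb{N}$ and partial free-variable label $\nearrow$. It is BESsy if: vertices decorated $\top,\bot$ or with a free variable have no successors; a vertex is decorated $\blacktriangle$/$\blacktriangledown$ or ranked iff it has a successor; vertices with multiple successors are decorated $\blacktriangle$ or $\blacktriangledown$; every cycle contains a ranked vertex. $\mathrm{norm}(t)$ is the same graph with every unranked vertex that has a successor given rank $0$. Fix a total order on variables/constants lifted to formulae; $\mathrm{Conj}(\emptyset)=\mathsf{true}$, $\mathrm{Conj}(\{f\})=f\wedge f$, $\mathrm{Conj}(\{f\}\cup F)=f\wedge\mathrm{Conj}(F)$ for $f$ smaller than all of $F$; $\mathrm{Disj}$ dually with $\mathsf{false},\vee$. $\varphi(u)$ is $\mathrm{Conj}\{\varphi(u')\mid u\to u'\}$ (resp. $\mathrm{Disj}$) if $d(u)=\blacktriangle$ (resp. $\blacktriangledown$) and $u$ unranked, $\mathsf{true}$/$\mathsf{false}$ if $d(u)=\top/\bot$, $X$ if $\nearrow(u)=X$, and a fresh variable $X_u$ otherwise. $\mathrm{BES}(t)$ contains, for each ranked vertex $u$, an equation $\sigma X_u =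 \mathrm{rhs}(u)$ ($\sigma=\mu$ iff rank odd), ordered by descending rank, where $\mathrm{rhs}(u)$ is $\mathrm{Conj}\{\varphi(u')\mid u\to u'\}$ if $d(u)=\blacktriangle$, $\mathrm{Disj}\{\varphi(u')\mid u\to u'\}$ if $d(u)=\blacktriangledown$, else $\varphi(u')$ for the unique successor. $[\![\cdot]\!]\eta$ denotes BES solution/formula evaluation. -}

module Defs where

open import Data.Nat using (ℕ; zero; suc; _≡ᵇ_; _<ᵇ_)
open import Data.Fin using (Fin; toℕ)
open import Data.Bool using (Bool; true; false; if_then_else_; _∧_; _∨_; not; T)
open import Data.Maybe using (Maybe; just; nothing; Is-just)
open import Data.List using (List; []; _∷_; map; allFin; foldr)
open import Data.List.Relation.Unary.Any using (Any)
open import Data.Sum using (_⊎_; inj₁; inj₂)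
open import Data.Product using (_×_; _,_; ∃-syntax)
open import Relation.Binary.PropositionalEquality using (_≡_; _≢_)
open import Function.Bundles using (_⇔_)

data Deco : Set where
  ▲ ▼ ⊤d ⊥d : Deco

record SG (n : ℕ) : Set where
  field
    root : Fin n
    E    : Fin n → Fin n → Bool
    d    : Fin n → Maybe Deco
    r    : Fin n → Maybe ℕ
    fv   : Fin n → Maybe ℕ

open SG public

data Walk {n : ℕ} (t : SG n) : Fin n → Fin n → Set where
  edge : ∀ {u v} → E t u v ≡ true → Walk t u v
  step : ∀ {u v w} → E t u v ≡ true → Walk t v w → Walk t u w

verts : ∀ {n} {t : SG n} {u w} → Walk t u w → List (Fin n)
verts (edge {u} _)     = u ∷ []
verts (step {u} _ p)   = u ∷ verts p

HasSucc : ∀ {n} → SG n → Fin n → Set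
HasSucc t u = ∃[ v ] E t u v ≡ true

IsAndOr : Maybe Deco → Set
IsAndOr m = (m ≡ just ▲) ⊎ (m ≡ just ▼)

record BESsy {n : ℕ} (t : SG n) : Set where
  field
    leaves   : ∀ u → (d t u ≡ just ⊤d ⊎ d t u ≡ just ⊥d ⊎ Is-just (fv t u)) →
               ∀ v → E t u v ≡ false
    succIff  : ∀ u → (IsAndOr (d t u) ⊎ Is-just (r t u)) ⇔ HasSucc t u
    multi    : ∀ u v w → E t u v ≡ true → E t u w ≡ true → v ≢ w →
               IsAndOr (d t u)
    cycles   : ∀ u (c : Walk t u u) → Any (λ v → Is-just (r t v)) (verts c)

filterB : ∀ {A : Set} → (A → Bool) → List A → List A
filterB p []       = []
filterB p (x ∷ xs) = if p x then x ∷ filterB p xs else filterB p xs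

succs : ∀ {n} → SG n → Fin n → List (Fin n)
succs {n} t u = filterB (E t u) (allFin n)

hasSuccᵇ : ∀ {n} → SG n → Fin n → Bool
hasSuccᵇ t u with succs t u
... | []    = false
... | _ ∷ _ = true

norm : ∀ {n} → SG n → SG n
norm t = record
  { root = root t ; E = E t ; d = d t ; fv = fv t
  ; r = λ u → newRank u (r t u) }
  where
  newRank : _ → Maybe ℕ → Maybe ℕ
  newRank u (just k) = just k
  newRank u nothing  = if hasSuccᵇ t u then just 0 else nothing

-- Variables: free variables (inj₁ X) and fresh variables X_u (inj₂ u).

Var : ℕ → Set
Var n = ℕ ⊎ Fin n

data Form (V : Set) : Set where
  tt ff : Form V
  var   : V → Form V
  _∧'_ _∨'_ : Form V → Form V → Form V

data Cmp : Set where
  lt eq gt : Cmp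

cmpℕ : ℕ → ℕ → Cmp
cmpℕ zero    zero    = eq
cmpℕ zero    (suc _) = lt
cmpℕ (suc _) zero    = gt
cmpℕ (suc m) (suc n) = cmpℕ m n

cmpVar : ∀ {n} → Var n → Var n → Cmp
cmpVar (inj₁ x) (inj₁ y) = cmpℕ x y
cmpVar (inj₁ _) (inj₂ _) = lt
cmpVar (inj₂ _) (inj₁ _) = gt
cmpVar (inj₂ x) (inj₂ y) = cmpℕ (toℕ x) (toℕ y)

lex : Cmp → Cmp → Cmp
lex eq c = c
lex c  _ = c

tag : ∀ {V} → Form V → ℕ
tag tt        = 0
tag ff        = 1
tag (var _)   = 2
tag (_ ∧' _)  = 3
tag (_ ∨' _)  = 4

cmpF : ∀ {n} → Form (Var n) → Form (Var n) → Cmp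
cmpF tt        tt        = eq
cmpF ff        ff        = eq
cmpF (var x)   (var y)   = cmpVar x y
cmpF (f ∧' g)  (f' ∧' g') = lex (cmpF f f') (cmpF g g')
cmpF (f ∨' g)  (f' ∨' g') = lex (cmpF f f') (cmpF g g')
cmpF f g = cmpℕ (tag f) (tag g)

-- insert into a strictly ascending list, dropping duplicates (set semantics)
insertF : ∀ {n} → Form (Var n) → List (Form (Var n)) → List (Form (Var n))
insertF f []       = f ∷ []
insertF f (g ∷ gs) with cmpF f g
... | lt = f ∷ g ∷ gs
... | eq = g ∷ gs
... | gt = g ∷ insertF f gs

toSet : ∀ {n} → List (Form (Var n)) → List (Form (Var n))
toSet = foldr insertF []

conjL disjL : ∀ {V} → List (Form V) → Form V
conjL []          = tt
conjL (f ∷ [])    = f ∧' f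
conjL (f ∷ g ∷ F) = f ∧' conjL (g ∷ F)
disjL []          = ff
disjL (f ∷ [])    = f ∨' f
disjL (f ∷ g ∷ F) = f ∨' disjL (g ∷ F)

Conj Disj : ∀ {n} → List (Form (Var n)) → Form (Var n)
Conj F = conjL (toSet F)
Disj F = disjL (toSet F)

-- Cases are tried in the order listed in the paper.  The recursion
-- only passes through unranked ▲/▼ vertices; fuel n (number of vertices)
-- suffices for BESsy graphs, since every cycle has a ranked vertex.

leafF : ∀ {n} → SG n → Fin n → Form (Var n)
leafF t u with d t u | fv t u
... | just ⊤d | _      = tt
... | just ⊥d | _      = ff
... | _       | just X = var (inj₁ X)
... | _       | nothing = var (inj₂ u)

φF : ∀ {n} → SG n → ℕ → Fin n → Form (Var n)
φF t k u with d t u | r t u | k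
... | just ▲ | nothing | zero  = var (inj₂ u)   -- unreachable for BESsy t
... | just ▲ | nothing | suc k' = Conj (map (φF t k') (succs t u))
... | just ▼ | nothing | zero  = var (inj₂ u)   -- unreachable for BESsy t
... | just ▼ | nothing | suc k' = Disj (map (φF t k') (succs t u))
... | _      | _       | _     = leafF t u

φ : ∀ {n} → SG n → Fin n → Form (Var n)
φ {n} t = φF t n

φroot : ∀ {n} → SG n → Form (Var n)
φroot t = φ t (root t)

data Sign : Set where
  μ ν : Sign

oddᵇ : ℕ → Bool
oddᵇ zero    = false
oddᵇ (suc k) = not (oddᵇ k)

rhs : ∀ {n} → SG n → Fin n → Form (Var n)
rhs t u with d t u | succs t u
... | just ▲ | S     = Conj (map (φ t) S)
... | just ▼ | S     = Disj (map (φ t) S)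
... | _      | v ∷ _ = φ t v
... | _      | []    = tt   -- unreachable for BESsy t (ranked ⇒ has successor)

Equation : ℕ → Set
Equation n = Sign × Var n × Form (Var n)

rankedVerts : ∀ {n} → SG n → List (Fin n) → List (Fin n × ℕ)
rankedVerts t []       = []
rankedVerts t (u ∷ us) with r t u
... | just k  = (u , k) ∷ rankedVerts t us
... | nothing = rankedVerts t us

-- stable insertion sort by descending rank (ties: ascending vertex index)
insR : ∀ {n} → Fin n × ℕ → List (Fin n × ℕ) → List (Fin n × ℕ)
insR x [] = x ∷ []
insR (u , k) ((v , l) ∷ ys) =
  if k <ᵇ l then (v , l) ∷ insR (u , k) ys else (u , k) ∷ (v , l) ∷ ys

BES : ∀ {n} → SG n → List (Equation n)
BES {n} t = map mkEq (foldr insR [] (rankedVerts t (allFin n)))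
  where
  mkEq : Fin n × ℕ → Equation n
  mkEq (u , k) = (if oddᵇ k then μ else ν) , inj₂ u , rhs t u

Env : ℕ → Set
Env n = Var n → Bool

eqVar : ∀ {n} → Var n → Var n → Bool
eqVar (inj₁ x) (inj₁ y) = x ≡ᵇ y
eqVar (inj₂ x) (inj₂ y) = toℕ x ≡ᵇ toℕ y
eqVar _ _ = false

_[_≔_] : ∀ {n} → Env n → Var n → Bool → Env n
(η [ X ≔ b ]) Y = if eqVar Y X then b else η Y

⟦_⟧F : ∀ {n} → Form (Var n) → Env n → Bool
⟦ tt ⟧F η     = true
⟦ ff ⟧F η     = false
⟦ var X ⟧F η  = η X
⟦ f ∧' g ⟧F η = ⟦ f ⟧F η ∧ ⟦ g ⟧F η
⟦ f ∨' g ⟧F η = ⟦ f ⟧F η ∨ ⟦ g ⟧F η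

-- Extremal fixpoints of a map Bool → Bool: for monotone g (all right-hand
-- sides here are positive, hence monotone) the least fixpoint is g false
-- and the greatest fixpoint is g true (Kleene iteration on the
-- two-element lattice stabilises after one step).
fixσ : Sign → (Bool → Bool) → Bool
fixσ μ g = g false
fixσ ν g = g true

⟦_⟧B : ∀ {n} → List (Equation n) → Env n → Env n
⟦ [] ⟧B η = η
⟦ (σ , X , f) ∷ ℰ ⟧B η =
  ⟦ ℰ ⟧B (η [ X ≔ fixσ σ (λ b → ⟦ f ⟧F (⟦ ℰ ⟧B (η [ X ≔ b ]))) ])

-- norm t gives rank 0 to exactly the vertices that φ unfolds (the unranked ▲/▼ vertices, called
-- promoted below). Hence φ(norm t) is the leaf formula at every vertex, and, sorting being stable with
-- rank 0 last, BES(norm t) is BES(t) with the ν-equations X_u = rhs(u) of the promoted vertices added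
-- to the final rank-0 block. Every cycle passes through a ranked vertex, so these added equations are
-- acyclic and every solution assigns X_u the value of φ(t)(u). Comparing the two rank-0 blocks through
-- their greatest-postfixpoint characterisation, in both directions, shows that their solutions agree
-- on all old variables; the equations of positive rank then have right-hand sides of equal value on
-- both sides, so both systems give φ at the root the same value.

module Submission where

open import Defs
open import Algebra.Bundles using (IdempotentCommutativeMonoid)
import Algebra.Properties.CommutativeSemigroup as CommutativeSemigroupProperties
open import Data.Bool using (Bool; true; false; _∧_; _∨_; if_then_else_; T; _≤_; b≤b; f≤t)
open import Data.Bool.Properties
  using (≤-refl; ≤-reflexive; ≤-trans; ≤-antisym; ≤-minimum; ≤-maximum; T-≡;
         ∧-idem; ∨-idem; ∧-identityʳ; ∨-identityʳ;
         ∧-idempotentCommutativeMonoid; ∨-idempotentCommutativeMonoid)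
open import Data.Empty using (⊥-elim)
open import Data.Fin as Fin using (Fin; toℕ)
open import Data.Fin.Properties using (toℕ-injective; pigeonhole)
open import Data.Bool.ListAction using (and; or)
open import Data.List using (List; []; _∷_; _++_; map; foldr; allFin; filterᵇ)
open import Data.List.Properties using (map-∘; map-cong; map-cong-local; map-++; ∷-injectiveˡ)
open import Data.List.Membership.Propositional using (_∈_)
open import Data.List.Membership.Propositional.Properties using (∈-allFin; ∈-filter⁺; ∈-filter⁻)
open import Data.List.Relation.Unary.All as All using (All; []; _∷_)
open import Data.List.Relation.Unary.All.Properties using (All¬⇒¬Any)
open import Data.List.Relation.Unary.Any using (Any; here; there)
open import Data.List.Relation.Unary.Unique.Propositional using (Unique; _∷_)
open import Data.List.Relation.Unary.Unique.Propositional.Properties using (allFin⁺; filter⁺)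
open import Data.Maybe using (Maybe; just; nothing; Is-just; is-nothing)
import Data.Maybe.Relation.Unary.Any as MaybeAny
open import Data.Nat using (ℕ; zero; suc; _<ᵇ_; s≤s; z≤n) renaming (_≤_ to _≤ℕ_)
open import Data.Nat.Properties using (≡ᵇ⇒≡; ≡⇒≡ᵇ; n≤1+n) renaming (≤-refl to ≤ℕ-refl)
open import Data.Product using (_×_; _,_; Σ; proj₁; proj₂)
open import Data.Sum using (_⊎_; inj₁; inj₂)
open import Data.Sum.Properties using (inj₂-injective)
open import Function using (_∘_; case_of_)
open import Function.Bundles using (Equivalence)
open import Level using (0ℓ)
open import Relation.Nullary using (¬_)
open import Relation.Nullary.Decidable using (T?)
open import Relation.Binary.PropositionalEquality

private variable
  n k : ℕ
  t : SG n
  u v w : Fin n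
  σ σ' ρ τ : Env n
  X Y : Var n

_≤ᴱ_ : Env n → Env n → Set
σ ≤ᴱ σ' = ∀ X → σ X ≤ σ' X

∧-mono-≤ : ∀ {a a' b b'} → a ≤ a' → b ≤ b' → a ∧ b ≤ a' ∧ b'
∧-mono-≤ f≤t _ = ≤-minimum _
∧-mono-≤ {true} b≤b b≤b' = b≤b'
∧-mono-≤ {false} b≤b _ = b≤b

∨-mono-≤ : ∀ {a a' b b'} → a ≤ a' → b ≤ b' → a ∨ b ≤ a' ∨ b'
∨-mono-≤ f≤t _ = ≤-maximum _
∨-mono-≤ {true} b≤b _ = b≤b
∨-mono-≤ {false} b≤b b≤b' = b≤b'

⟦⟧F-mono : ∀ (f : Form (Var n)) → σ ≤ᴱ σ' → ⟦ f ⟧F σ ≤ ⟦ f ⟧F σ'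
⟦⟧F-mono tt _ = b≤b
⟦⟧F-mono ff _ = b≤b
⟦⟧F-mono (var X) σ≤σ' = σ≤σ' X
⟦⟧F-mono (f ∧' g) σ≤σ' = ∧-mono-≤ (⟦⟧F-mono f σ≤σ') (⟦⟧F-mono g σ≤σ')
⟦⟧F-mono (f ∨' g) σ≤σ' = ∨-mono-≤ (⟦⟧F-mono f σ≤σ') (⟦⟧F-mono g σ≤σ')

eqVar-refl : (X : Var n) → eqVar X X ≡ true
eqVar-refl (inj₁ x) = Equivalence.to T-≡ (≡⇒≡ᵇ x x refl)
eqVar-refl (inj₂ x) = Equivalence.to T-≡ (≡⇒≡ᵇ (toℕ x) (toℕ x) refl)

eqVar-sound : (X Y : Var n) → eqVar X Y ≡ true → X ≡ Y
eqVar-sound (inj₁ x) (inj₁ y) e = cong inj₁ (≡ᵇ⇒≡ x y (Equivalence.from T-≡ e))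
eqVar-sound (inj₂ x) (inj₂ y) e =
  cong inj₂ (toℕ-injective (≡ᵇ⇒≡ (toℕ x) (toℕ y) (Equivalence.from T-≡ e)))

update-same : ∀ (η : Env n) X b → (η [ X ≔ b ]) X ≡ b
update-same η X b rewrite eqVar-refl X = refl

update-other : ∀ (η : Env n) {X Y} b → Y ≢ X → (η [ X ≔ b ]) Y ≡ η Y
update-other η {X} {Y} b Y≢X with eqVar Y X in e
... | true = ⊥-elim (Y≢X (eqVar-sound Y X e))
... | false = refl

update-mono : ∀ {a a'} → σ ≤ᴱ σ' → a ≤ a' → (σ [ X ≔ a ]) ≤ᴱ (σ' [ X ≔ a' ])
update-mono {X = X} σ≤σ' a≤a' Y with eqVar Y X
... | true = a≤a'
... | false = σ≤σ' Y

fixσ-cong : ∀ s {g g' : Bool → Bool} → (∀ b → g b ≡ g' b) → fixσ s g ≡ fixσ s g'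
fixσ-cong μ g≗g' = g≗g' false
fixσ-cong ν g≗g' = g≗g' true

ν-fixed : (g : Bool → Bool) → g false ≤ g true → g (g true) ≡ g true
ν-fixed g mono with g true in e
... | true = e
... | false = ≤-antisym mono (≤-minimum _)

νSystem : (Fin n → Form (Var n)) → List (Fin n) → List (Equation n)
νSystem R = map (λ u → ν , inj₂ u , R u)

Unbound : Var n → List (Fin n) → Set
Unbound Y us = ∀ {u} → u ∈ us → Y ≢ inj₂ u

module _ (R : Fin n → Form (Var n)) where

  νSystem-frame : ∀ us ρ {Y} → Unbound Y us → ⟦ νSystem R us ⟧B ρ Y ≡ ρ Y
  νSystem-frame [] ρ _ = refl
  νSystem-frame (u ∷ us) ρ Y∉ =
    trans (νSystem-frame us _ (Y∉ ∘ there)) (update-other ρ _ (Y∉ (here refl)))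

  νSystem-mono : ∀ us → ρ ≤ᴱ τ → ⟦ νSystem R us ⟧B ρ ≤ᴱ ⟦ νSystem R us ⟧B τ
  νSystem-mono [] ρ≤τ = ρ≤τ
  νSystem-mono (u ∷ us) ρ≤τ = νSystem-mono us (update-mono ρ≤τ
    (⟦⟧F-mono (R u) (νSystem-mono us (update-mono ρ≤τ ≤-refl))))

  νSystem-solution : ∀ us → Unique us → ∀ ρ {u} → u ∈ us →
    ⟦ νSystem R us ⟧B ρ (inj₂ u) ≡ ⟦ R u ⟧F (⟦ νSystem R us ⟧B ρ)
  νSystem-solution (u ∷ us) (u∉us ∷ _) ρ (here refl) = begin
    ⟦ νSystem R us ⟧B (ρ [ inj₂ u ≔ g true ]) (inj₂ u)
      ≡⟨ νSystem-frame us _ (λ m → All.lookup u∉us m ∘ inj₂-injective) ⟩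
    (ρ [ inj₂ u ≔ g true ]) (inj₂ u) ≡⟨ update-same ρ (inj₂ u) (g true) ⟩
    g true                           ≡⟨ sym (ν-fixed g g-mono) ⟩
    g (g true)                       ∎
    where
    open ≡-Reasoning
    g : Bool → Bool
    g b = ⟦ R u ⟧F (⟦ νSystem R us ⟧B (ρ [ inj₂ u ≔ b ]))
    g-mono : g false ≤ g true
    g-mono = ⟦⟧F-mono (R u) (νSystem-mono us (update-mono (λ _ → ≤-refl) f≤t))
  νSystem-solution (_ ∷ us) (_ ∷ unique) ρ (there m) = νSystem-solution us unique _ m

  private
    bound-update : ∀ {u us b} → (∀ {Y} → Unbound Y (u ∷ us) → τ Y ≤ ρ Y) →
      τ (inj₂ u) ≤ b → ∀ {Y} → Unbound Y us → τ Y ≤ (ρ [ inj₂ u ≔ b ]) Y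
    bound-update {u = u} off τu≤b {Y} Y∉ with eqVar Y (inj₂ u) in e
    ... | true with refl ← eqVar-sound Y (inj₂ u) e = τu≤b
    ... | false = off λ where
      (here refl) refl → case trans (sym e) (eqVar-refl Y) of λ ()
      (there m) → Y∉ m

  νSystem-greatest : ∀ us ρ → (∀ {Y} → Unbound Y us → τ Y ≤ ρ Y) →
    (∀ {u} → u ∈ us → τ (inj₂ u) ≤ ⟦ R u ⟧F τ) → τ ≤ᴱ ⟦ νSystem R us ⟧B ρ
  νSystem-greatest [] ρ off post Y = off λ ()
  νSystem-greatest {τ = τ} (u ∷ us) ρ off post =
    νSystem-greatest us _ (bound-update off τu≤value) (post ∘ there)
    where
    τ≤top : τ ≤ᴱ ⟦ νSystem R us ⟧B (ρ [ inj₂ u ≔ true ])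
    τ≤top = νSystem-greatest us _ (bound-update off (≤-maximum _)) (post ∘ there)
    τu≤value : τ (inj₂ u) ≤ ⟦ R u ⟧F (⟦ νSystem R us ⟧B (ρ [ inj₂ u ≔ true ]))
    τu≤value = ≤-trans (post (here refl)) (⟦⟧F-mono (R u) τ≤top)

cmpℕ-eq : ∀ m k → cmpℕ m k ≡ eq → m ≡ k
cmpℕ-eq zero zero _ = refl
cmpℕ-eq (suc m) (suc k) e = cong suc (cmpℕ-eq m k e)

cmpVar-eq : (X Y : Var n) → cmpVar X Y ≡ eq → X ≡ Y
cmpVar-eq (inj₁ x) (inj₁ y) e = cong inj₁ (cmpℕ-eq x y e)
cmpVar-eq (inj₂ x) (inj₂ y) e = cong inj₂ (toℕ-injective (cmpℕ-eq (toℕ x) (toℕ y) e))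

lex-eq : ∀ c c' → lex c c' ≡ eq → c ≡ eq × c' ≡ eq
lex-eq eq c' e = refl , e

cmpF-eq : (f g : Form (Var n)) → cmpF f g ≡ eq → f ≡ g
cmpF-eq tt tt _ = refl
cmpF-eq ff ff _ = refl
cmpF-eq (var X) (var Y) e = cong var (cmpVar-eq X Y e)
cmpF-eq (f ∧' g) (f' ∧' g') e with lex-eq _ _ e
... | e₁ , e₂ = cong₂ _∧'_ (cmpF-eq f f' e₁) (cmpF-eq g g' e₂)
cmpF-eq (f ∨' g) (f' ∨' g') e with lex-eq _ _ e
... | e₁ , e₂ = cong₂ _∨'_ (cmpF-eq f f' e₁) (cmpF-eq g g' e₂)
cmpF-eq tt ff ()
cmpF-eq tt (var _) ()
cmpF-eq tt (_ ∧' _) ()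
cmpF-eq tt (_ ∨' _) ()
cmpF-eq ff tt ()
cmpF-eq ff (var _) ()
cmpF-eq ff (_ ∧' _) ()
cmpF-eq ff (_ ∨' _) ()
cmpF-eq (var _) tt ()
cmpF-eq (var _) ff ()
cmpF-eq (var _) (_ ∧' _) ()
cmpF-eq (var _) (_ ∨' _) ()
cmpF-eq (_ ∧' _) tt ()
cmpF-eq (_ ∧' _) ff ()
cmpF-eq (_ ∧' _) (var _) ()
cmpF-eq (_ ∧' _) (_ ∨' _) ()
cmpF-eq (_ ∨' _) tt ()
cmpF-eq (_ ∨' _) ff ()
cmpF-eq (_ ∨' _) (var _) ()
cmpF-eq (_ ∨' _) (_ ∧' _) ()

module _ (M : IdempotentCommutativeMonoid 0ℓ 0ℓ)
         (h : Form (Var n) → IdempotentCommutativeMonoid.Carrier M) where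
  open IdempotentCommutativeMonoid M
    using (Carrier; _≈_; _∙_; ε; assoc; idem; ∙-congˡ; ∙-congʳ; commutativeSemigroup)
    renaming (refl to ≈-refl; sym to ≈-sym; trans to ≈-trans)
  open CommutativeSemigroupProperties commutativeSemigroup using (x∙yz≈y∙xz)

  private
    fold : List (Form (Var n)) → Carrier
    fold F = foldr _∙_ ε (map h F)

  fold-insertF : ∀ f G → fold (insertF f G) ≈ h f ∙ fold G
  fold-insertF f [] = ≈-refl
  fold-insertF f (g ∷ G) with cmpF f g in c
  ... | lt = ≈-refl
  ... | eq with refl ← cmpF-eq f g c = ≈-sym (≈-trans (≈-sym (assoc _ _ _)) (∙-congʳ (idem _)))
  ... | gt = ≈-trans (∙-congˡ (fold-insertF f G)) (x∙yz≈y∙xz _ _ _)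

  fold-toSet : ∀ F → fold (toSet F) ≈ fold F
  fold-toSet [] = ≈-refl
  fold-toSet (f ∷ F) = ≈-trans (fold-insertF f (toSet F)) (∙-congˡ (fold-toSet F))

⟦_⟧F* : List (Form (Var n)) → Env n → List Bool
⟦ F ⟧F* σ = map (λ f → ⟦ f ⟧F σ) F

⟦conjL⟧ : ∀ L → ⟦ conjL L ⟧F σ ≡ and (⟦ L ⟧F* σ)
⟦conjL⟧ [] = refl
⟦conjL⟧ (f ∷ []) = trans (∧-idem _) (sym (∧-identityʳ _))
⟦conjL⟧ {σ = σ} (f ∷ g ∷ L) = cong (⟦ f ⟧F σ ∧_) (⟦conjL⟧ (g ∷ L))

⟦disjL⟧ : ∀ L → ⟦ disjL L ⟧F σ ≡ or (⟦ L ⟧F* σ)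
⟦disjL⟧ [] = refl
⟦disjL⟧ (f ∷ []) = trans (∨-idem _) (sym (∨-identityʳ _))
⟦disjL⟧ {σ = σ} (f ∷ g ∷ L) = cong (⟦ f ⟧F σ ∨_) (⟦disjL⟧ (g ∷ L))

⟦Conj⟧ : ∀ F → ⟦ Conj F ⟧F σ ≡ and (⟦ F ⟧F* σ)
⟦Conj⟧ {σ = σ} F =
  trans (⟦conjL⟧ (toSet F)) (fold-toSet ∧-idempotentCommutativeMonoid (λ f → ⟦ f ⟧F σ) F)

⟦Disj⟧ : ∀ F → ⟦ Disj F ⟧F σ ≡ or (⟦ F ⟧F* σ)
⟦Disj⟧ {σ = σ} F =
  trans (⟦disjL⟧ (toSet F)) (fold-toSet ∨-idempotentCommutativeMonoid (λ f → ⟦ f ⟧F σ) F)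

firstOr : List (Form (Var n)) → Form (Var n)
firstOr [] = tt
firstOr (f ∷ _) = f

rhsOf : Maybe Deco → List (Form (Var n)) → Form (Var n)
rhsOf (just ▲) = Conj
rhsOf (just ▼) = Disj
rhsOf _ = firstOr

⟦firstOr⟧-cong : ∀ {F G} → ⟦ F ⟧F* σ ≡ ⟦ G ⟧F* σ' →
  ⟦ firstOr F ⟧F σ ≡ ⟦ firstOr G ⟧F σ'
⟦firstOr⟧-cong {F = []} {[]} _ = refl
⟦firstOr⟧-cong {F = _ ∷ _} {_ ∷ _} e = ∷-injectiveˡ e

⟦rhsOf⟧-cong : ∀ dd {F G} → ⟦ F ⟧F* σ ≡ ⟦ G ⟧F* σ' →
  ⟦ rhsOf dd F ⟧F σ ≡ ⟦ rhsOf dd G ⟧F σ'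
⟦rhsOf⟧-cong (just ▲) {F} {G} e = trans (⟦Conj⟧ F) (trans (cong and e) (sym (⟦Conj⟧ G)))
⟦rhsOf⟧-cong (just ▼) {F} {G} e = trans (⟦Disj⟧ F) (trans (cong or e) (sym (⟦Disj⟧ G)))
⟦rhsOf⟧-cong (just ⊤d) = ⟦firstOr⟧-cong
⟦rhsOf⟧-cong (just ⊥d) = ⟦firstOr⟧-cong
⟦rhsOf⟧-cong nothing = ⟦firstOr⟧-cong

⟦map⟧-cong : ∀ {f g : Fin n → Form (Var n)} S →
  (∀ {v} → v ∈ S → ⟦ f v ⟧F σ ≡ ⟦ g v ⟧F σ') →
  ⟦ map f S ⟧F* σ ≡ ⟦ map g S ⟧F* σ'
⟦map⟧-cong S f≈g = trans (sym (map-∘ S)) (trans (map-cong-local (All.tabulate f≈g)) (map-∘ S))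

rhs-view : ∀ (t : SG n) u → rhs t u ≡ rhsOf (d t u) (map (φ t) (succs t u))
rhs-view t u with d t u | succs t u
... | just ▲ | _ = refl
... | just ▼ | _ = refl
... | just ⊤d | [] = refl
... | just ⊤d | _ ∷ _ = refl
... | just ⊥d | [] = refl
... | just ⊥d | _ ∷ _ = refl
... | nothing | [] = refl
... | nothing | _ ∷ _ = refl

varOf : Fin n → Maybe ℕ → Form (Var n)
varOf u (just X) = var (inj₁ X)
varOf u nothing = var (inj₂ u)

leafOf : Fin n → Maybe Deco → Maybe ℕ → Form (Var n)
leafOf u (just ⊤d) _ = tt
leafOf u (just ⊥d) _ = ff
leafOf u _ m = varOf u m

leafF-view : ∀ (t : SG n) u → leafF t u ≡ leafOf u (d t u) (fv t u)
leafF-view t u with d t u | fv t u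
... | just ⊤d | _ = refl
... | just ⊥d | _ = refl
... | just ▲ | just _ = refl
... | just ▲ | nothing = refl
... | just ▼ | just _ = refl
... | just ▼ | nothing = refl
... | nothing | just _ = refl
... | nothing | nothing = refl

⟦varOf⟧-cong : ∀ m → σ (inj₂ u) ≡ σ' (inj₂ u) →
  (∀ X → σ (inj₁ X) ≡ σ' (inj₁ X)) →
  ⟦ varOf u m ⟧F σ ≡ ⟦ varOf u m ⟧F σ'
⟦varOf⟧-cong (just X) _ same₁ = same₁ X
⟦varOf⟧-cong nothing same₂ _ = same₂

⟦leafOf⟧-cong : ∀ dd m → σ (inj₂ u) ≡ σ' (inj₂ u) →
  (∀ X → σ (inj₁ X) ≡ σ' (inj₁ X)) →
  ⟦ leafOf u dd m ⟧F σ ≡ ⟦ leafOf u dd m ⟧F σ'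
⟦leafOf⟧-cong (just ⊤d) _ _ _ = refl
⟦leafOf⟧-cong (just ⊥d) _ _ _ = refl
⟦leafOf⟧-cong (just ▲) m = ⟦varOf⟧-cong m
⟦leafOf⟧-cong (just ▼) m = ⟦varOf⟧-cong m
⟦leafOf⟧-cong nothing m = ⟦varOf⟧-cong m

leafF-andOr : ∀ (t : SG n) {u} → IsAndOr (d t u) → fv t u ≡ nothing → leafF t u ≡ var (inj₂ u)
leafF-andOr t {u} (inj₁ ed) ef rewrite leafF-view t u | ed | ef = refl
leafF-andOr t {u} (inj₂ ed) ef rewrite leafF-view t u | ed | ef = refl

Inner : SG n → Fin n → Set
Inner t u = r t u ≡ nothing × IsAndOr (d t u)

φStep : SG n → Fin n → Maybe Deco → Maybe ℕ → ℕ → Form (Var n)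
φStep t u (just ▲) nothing (suc k) = Conj (map (φF t k) (succs t u))
φStep t u (just ▼) nothing (suc k) = Disj (map (φF t k) (succs t u))
φStep t u (just ▲) nothing zero = var (inj₂ u)
φStep t u (just ▼) nothing zero = var (inj₂ u)
φStep t u _ _ _ = leafF t u

φF-view : ∀ (t : SG n) k u → φF t k u ≡ φStep t u (d t u) (r t u) k
φF-view t k u with d t u | r t u | k
... | just ▲ | nothing | zero = refl
... | just ▲ | nothing | suc _ = refl
... | just ▼ | nothing | zero = refl
... | just ▼ | nothing | suc _ = refl
... | just ▲ | just _ | _ = refl
... | just ▼ | just _ | _ = refl
... | just ⊤d | _ | _ = refl
... | just ⊥d | _ | _ = refl
... | nothing | _ | _ = refl

φF-leaf : ∀ (t : SG n) {u} k → ¬ Inner t u → φF t k u ≡ leafF t u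
φF-leaf t {u} k ¬inner = trans (φF-view t k u) (go (d t u) (r t u) refl refl)
  where
  go : ∀ dd rr → d t u ≡ dd → r t u ≡ rr → φStep t u dd rr k ≡ leafF t u
  go (just ▲) nothing ed er = ⊥-elim (¬inner (er , inj₁ ed))
  go (just ▼) nothing ed er = ⊥-elim (¬inner (er , inj₂ ed))
  go (just ▲) (just _) _ _ = refl
  go (just ▼) (just _) _ _ = refl
  go (just ⊤d) _ _ _ = refl
  go (just ⊥d) _ _ _ = refl
  go nothing _ _ _ = refl

φF-inner : ∀ (t : SG n) {u} k → Inner t u →
  φF t (suc k) u ≡ rhsOf (d t u) (map (φF t k) (succs t u))
φF-inner t {u} k (er , inj₁ ed) rewrite φF-view t (suc k) u | er | ed = refl
φF-inner t {u} k (er , inj₂ ed) rewrite φF-view t (suc k) u | er | ed = refl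

filterB≡filterᵇ : ∀ {A : Set} (p : A → Bool) xs → filterB p xs ≡ filterᵇ p xs
filterB≡filterᵇ p [] = refl
filterB≡filterᵇ p (x ∷ xs) with p x
... | true = cong (x ∷_) (filterB≡filterᵇ p xs)
... | false = filterB≡filterᵇ p xs

∈-succs⁻ : ∀ {n} (t : SG n) {u v} → v ∈ succs t u → E t u v ≡ true
∈-succs⁻ {n} t {u} m = Equivalence.to T-≡ (proj₂ (∈-filter⁻ (T? ∘ E t u) {xs = allFin n}
  (subst (_ ∈_) (filterB≡filterᵇ (E t u) (allFin n)) m)))

∈-succs⁺ : ∀ {n} (t : SG n) {u v} → E t u v ≡ true → v ∈ succs t u
∈-succs⁺ {n} t {u} {v} e = subst (v ∈_) (sym (filterB≡filterᵇ (E t u) (allFin n)))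
  (∈-filter⁺ (T? ∘ E t u) (∈-allFin v) (Equivalence.from T-≡ e))

hasSuccᵇ⇒HasSucc : ∀ (t : SG n) {u} → hasSuccᵇ t u ≡ true → HasSucc t u
hasSuccᵇ⇒HasSucc t {u} h with succs t u in e
... | v ∷ _ = v , ∈-succs⁻ t (subst (v ∈_) (sym e) (here refl))

HasSucc⇒hasSuccᵇ : ∀ (t : SG n) {u} → HasSucc t u → hasSuccᵇ t u ≡ true
HasSucc⇒hasSuccᵇ t {u} (v , e) with succs t u | ∈-succs⁺ t e
... | _ ∷ _ | _ = refl

promoted : SG n → Fin n → Bool
promoted t u = is-nothing (r t u) ∧ hasSuccᵇ t u

promotedVar : SG n → Var n → Bool
promotedVar t (inj₁ _) = false
promotedVar t (inj₂ w) = promoted t w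

promoted⇒unranked : ∀ (t : SG n) {u} → promoted t u ≡ true → r t u ≡ nothing
promoted⇒unranked t {u} p with r t u
... | nothing = refl

ranked⇒unpromoted : ∀ (t : SG n) {u} → r t u ≡ just k → promoted t u ≡ false
ranked⇒unpromoted t er rewrite er = refl

rank-norm-promoted : ∀ (t : SG n) {u} → promoted t u ≡ true → r (norm t) u ≡ just 0
rank-norm-promoted t {u} p with r t u
... | nothing rewrite p = refl

rank-norm-unpromoted : ∀ (t : SG n) {u} → promoted t u ≡ false → r (norm t) u ≡ r t u
rank-norm-unpromoted t {u} p with r t u
... | just _ = refl
... | nothing rewrite p = refl

consRanked : Fin n → Maybe ℕ → List (Fin n × ℕ) → List (Fin n × ℕ)
consRanked u (just k) L = (u , k) ∷ L
consRanked u nothing L = L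

rankedVerts-cons : ∀ (t : SG n) u us →
  rankedVerts t (u ∷ us) ≡ consRanked u (r t u) (rankedVerts t us)
rankedVerts-cons t u us with r t u
... | just _ = refl
... | nothing = refl

sortByRank : List (Fin n × ℕ) → List (Fin n × ℕ)
sortByRank = foldr insR []

positives : List (Fin n × ℕ) → List (Fin n × ℕ)
positives [] = []
positives ((u , zero) ∷ xs) = positives xs
positives ((u , suc k) ∷ xs) = (u , suc k) ∷ positives xs

zeros : List (Fin n × ℕ) → List (Fin n)
zeros [] = []
zeros ((u , zero) ∷ xs) = u ∷ zeros xs
zeros ((u , suc k) ∷ xs) = zeros xs

atRankZero : List (Fin n) → List (Fin n × ℕ)
atRankZero = map (_, 0)

RankPositive : Fin n × ℕ → Set
RankPositive (_ , k) = (0 <ᵇ k) ≡ true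

insR-zero : ∀ u P Z → All (RankPositive {n}) P →
  insR (u , 0) (P ++ atRankZero Z) ≡ P ++ atRankZero (u ∷ Z)
insR-zero u [] [] [] = refl
insR-zero u [] (_ ∷ _) [] = refl
insR-zero u ((v , suc l) ∷ P) Z (_ ∷ P⁺) = cong ((v , suc l) ∷_) (insR-zero u P Z P⁺)

insR-suc : ∀ u k P Z →
  insR {n} (u , suc k) (P ++ atRankZero Z) ≡ insR (u , suc k) P ++ atRankZero Z
insR-suc u k [] [] = refl
insR-suc u k [] (_ ∷ _) = refl
insR-suc u k ((v , l) ∷ P) Z with suc k <ᵇ l
... | true = cong ((v , l) ∷_) (insR-suc u k P Z)
... | false = refl

insR-positive : ∀ u k P → All (RankPositive {n}) P → All RankPositive (insR (u , suc k) P)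
insR-positive u k [] [] = refl ∷ []
insR-positive u k ((v , l) ∷ P) (v⁺ ∷ P⁺) with suc k <ᵇ l
... | true = v⁺ ∷ insR-positive u k P P⁺
... | false = refl ∷ v⁺ ∷ P⁺

sortByRank-positives : ∀ (xs : List (Fin n × ℕ)) → All RankPositive (sortByRank (positives xs))
sortByRank-positives [] = []
sortByRank-positives ((u , zero) ∷ xs) = sortByRank-positives xs
sortByRank-positives ((u , suc k) ∷ xs) = insR-positive u k _ (sortByRank-positives xs)

-- Sorting is stable and rank 0 is the least rank, so the rank-0 entries come last, in list order.
sortByRank-split : ∀ (xs : List (Fin n × ℕ)) →
  sortByRank xs ≡ sortByRank (positives xs) ++ atRankZero (zeros xs)
sortByRank-split [] = refl
sortByRank-split ((u , zero) ∷ xs) = trans (cong (insR (u , 0)) (sortByRank-split xs))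
  (insR-zero u _ (zeros xs) (sortByRank-positives xs))
sortByRank-split ((u , suc k) ∷ xs) = trans (cong (insR (u , suc k)) (sortByRank-split xs))
  (insR-suc u k (sortByRank (positives xs)) (zeros xs))

isZeroRank : Maybe ℕ → Bool
isZeroRank (just zero) = true
isZeroRank _ = false

zeroRanked : SG n → List (Fin n)
zeroRanked {n} t = filterᵇ (isZeroRank ∘ r t) (allFin n)

zeros-rankedVerts : ∀ (t : SG n) us → zeros (rankedVerts t us) ≡ filterᵇ (isZeroRank ∘ r t) us
zeros-rankedVerts t [] = refl
zeros-rankedVerts t (u ∷ us) with r t u
... | just zero = cong (u ∷_) (zeros-rankedVerts t us)
... | just (suc _) = zeros-rankedVerts t us
... | nothing = zeros-rankedVerts t us

∈-zeroRanked⁻ : ∀ (t : SG n) {u} → u ∈ zeroRanked t → r t u ≡ just 0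
∈-zeroRanked⁻ {n} t {u} m
  with r t u | proj₂ (∈-filter⁻ (T? ∘ isZeroRank ∘ r t) {xs = allFin n} m)
... | just zero | _ = refl

∈-zeroRanked⁺ : ∀ (t : SG n) {u} → r t u ≡ just 0 → u ∈ zeroRanked t
∈-zeroRanked⁺ {n} t {u} e =
  ∈-filter⁺ (T? ∘ isZeroRank ∘ r t) (∈-allFin u) (subst (T ∘ isZeroRank) (sym e) _)

zeroRanked-unique : (t : SG n) → Unique (zeroRanked t)
zeroRanked-unique {n} t = filter⁺ (T? ∘ isZeroRank ∘ r t) (allFin⁺ n)

equation : SG n → Fin n × ℕ → Equation n
equation t (u , k) = (if oddᵇ k then μ else ν) , inj₂ u , rhs t u

system : SG n → List (Fin n × ℕ) → List (Equation n)
system t P = map (equation t) P ++ νSystem (rhs t) (zeroRanked t)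

BES-split : ∀ (t : SG n) → BES t ≡ system t (sortByRank (positives (rankedVerts t (allFin n))))
BES-split {n} t = begin
  BES t                                         ≡⟨ map-cong (λ _ → refl) (sortByRank xs) ⟩
  map (equation t) (sortByRank xs)              ≡⟨ cong (map (equation t)) (sortByRank-split xs) ⟩
  map (equation t) (P ++ atRankZero (zeros xs)) ≡⟨ map-++ (equation t) P _ ⟩
  map (equation t) P ++ map (equation t) (atRankZero (zeros xs))
    ≡⟨ cong (map (equation t) P ++_) (sym (map-∘ (zeros xs))) ⟩
  map (equation t) P ++ νSystem (rhs t) (zeros xs)
    ≡⟨ cong (λ Z → map (equation t) P ++ νSystem (rhs t) Z) (zeros-rankedVerts t (allFin n)) ⟩
  system t P                                    ∎
  where
  open ≡-Reasoning
  xs = rankedVerts t (allFin n)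
  P = sortByRank (positives xs)

positives-consRanked : ∀ u m {L L' : List (Fin n × ℕ)} → positives L ≡ positives L' →
  positives (consRanked u m L) ≡ positives (consRanked u m L')
positives-consRanked u (just zero) e = e
positives-consRanked u (just (suc k)) e = cong ((u , suc k) ∷_) e
positives-consRanked u nothing e = e

positives-norm : ∀ (t : SG n) us → positives (rankedVerts (norm t) us) ≡ positives (rankedVerts t us)
positives-norm t [] = refl
positives-norm t (u ∷ us) = begin
  positives (rankedVerts (norm t) (u ∷ us))
    ≡⟨ cong positives (rankedVerts-cons (norm t) u us) ⟩
  positives (consRanked u (r (norm t) u) (rankedVerts (norm t) us))
    ≡⟨ head-step ⟩
  positives (consRanked u (r t u) (rankedVerts t us))
    ≡⟨ cong positives (rankedVerts-cons t u us) ⟨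
  positives (rankedVerts t (u ∷ us))
    ∎
  where
  open ≡-Reasoning
  head-step : positives (consRanked u (r (norm t) u) (rankedVerts (norm t) us))
            ≡ positives (consRanked u (r t u) (rankedVerts t us))
  head-step with promoted t u in p
  ... | true rewrite rank-norm-promoted t p | promoted⇒unranked t p = positives-norm t us
  ... | false rewrite rank-norm-unpromoted t p = positives-consRanked u (r t u) (positives-norm t us)

zeroRanked-norm⁺ : ∀ (t : SG n) {u} → u ∈ zeroRanked t → u ∈ zeroRanked (norm t)
zeroRanked-norm⁺ t m =
  ∈-zeroRanked⁺ (norm t) (trans (rank-norm-unpromoted t (ranked⇒unpromoted t r0)) r0)
  where r0 = ∈-zeroRanked⁻ t m

zeroRanked-norm-promoted : ∀ (t : SG n) {u} → promoted t u ≡ true → u ∈ zeroRanked (norm t)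
zeroRanked-norm-promoted t p = ∈-zeroRanked⁺ (norm t) (rank-norm-promoted t p)

zeroRanked-norm⁻ : ∀ (t : SG n) {u} → u ∈ zeroRanked (norm t) →
  u ∈ zeroRanked t ⊎ promoted t u ≡ true
zeroRanked-norm⁻ t {u} m with promoted t u in p
... | true = inj₂ refl
... | false =
  inj₁ (∈-zeroRanked⁺ t (trans (sym (rank-norm-unpromoted t p)) (∈-zeroRanked⁻ (norm t) m)))

data UnrankedChain (t : SG n) : ℕ → Fin n → Set where
  stop : ∀ {v} → r t v ≡ nothing → UnrankedChain t 0 v
  step : ∀ {k u w} → r t u ≡ nothing → E t u w ≡ true → UnrankedChain t k w →
         UnrankedChain t (suc k) u

vertexAt : ∀ {n k} {t : SG n} {v} → UnrankedChain t k v → Fin (suc k) → Fin n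
vertexAt {v = v} _ Fin.zero = v
vertexAt (step _ _ c) (Fin.suc i) = vertexAt c i

segment : ∀ {n k} {t : SG n} {v} (c : UnrankedChain t k v) {i j : Fin (suc k)} → i Fin.< j →
  Σ (Walk t (vertexAt c i) (vertexAt c j)) (All (λ x → r t x ≡ nothing) ∘ verts)
segment (step ur e c) {Fin.zero} {Fin.suc Fin.zero} _ = edge e , ur ∷ []
segment (step ur e c) {Fin.zero} {Fin.suc (Fin.suc j)} _
  with walk , unranked ← segment c {Fin.zero} {Fin.suc j} (s≤s z≤n) = step e walk , ur ∷ unranked
segment (step _ _ c) {Fin.suc i} {Fin.suc j} (s≤s i<j) = segment c i<j

unranked⇒¬isJust : ∀ {m : Maybe ℕ} → m ≡ nothing → ¬ Is-just m
unranked⇒¬isJust refl ()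

cycle-ranked : BESsy t → ∀ {x y} (walk : Walk t x y) → x ≡ y →
  Any (λ v → Is-just (r t v)) (verts walk)
cycle-ranked bessy walk refl = BESsy.cycles bessy _ walk

-- A chain through n + 1 unranked vertices repeats a vertex, giving an unranked cycle.
no-long-chain : ∀ {t : SG n} → BESsy t → n ≤ℕ k → ¬ UnrankedChain t k v
no-long-chain bessy n≤k c with i , j , i<j , same ← pigeonhole (s≤s n≤k) (vertexAt c)
  with walk , unranked ← segment c i<j
  = All¬⇒¬Any (All.map unranked⇒¬isJust unranked) (cycle-ranked bessy walk same)

¬chain-succ : ∀ (t : SG n) {v w k} → r t v ≡ nothing → w ∈ succs t v →
  ¬ UnrankedChain t (suc k) v → ¬ UnrankedChain t k w
¬chain-succ t ur m ¬c c = ¬c (step ur (∈-succs⁻ t m) c)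

module _ {n} (t : SG n) (bessy : BESsy t) where
  open BESsy bessy

  promoted⇒inner : promoted t u ≡ true → Inner t u
  promoted⇒inner {u} p with r t u in er
  ... | nothing with Equivalence.from (succIff u) (hasSuccᵇ⇒HasSucc t p)
  ...   | inj₁ andOr = refl , andOr
  ...   | inj₂ ranked = ⊥-elim (unranked⇒¬isJust er ranked)

  inner⇒promoted : Inner t u → promoted t u ≡ true
  inner⇒promoted {u} (er , andOr) rewrite er =
    HasSucc⇒hasSuccᵇ t (Equivalence.to (succIff u) (inj₁ andOr))

  unpromoted⇒¬inner : promoted t u ≡ false → ¬ Inner t u
  unpromoted⇒¬inner p inner = case trans (sym p) (inner⇒promoted inner) of λ ()

  andOr⇒no-fv : IsAndOr (d t u) → fv t u ≡ nothing
  andOr⇒no-fv {u} andOr with fv t u in ef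
  ... | nothing = refl
  ... | just _ with v , e ← Equivalence.to (succIff u) (inj₁ andOr) =
    case trans (sym e) (leaves u (inj₂ (inj₂ (subst Is-just (sym ef) (MaybeAny.just _)))) v) of λ ()

  ¬inner-norm : ¬ Inner (norm t) u
  ¬inner-norm {u} (er , andOr) with promoted t u in p
  ... | true = case trans (sym er) (rank-norm-promoted t p) of λ ()
  ... | false = unpromoted⇒¬inner p (trans (sym (rank-norm-unpromoted t p)) er , andOr)

  φF-norm : ∀ k v → φF (norm t) k v ≡ leafF t v
  φF-norm k v = trans (φF-leaf (norm t) k ¬inner-norm)
    (trans (leafF-view (norm t) v) (sym (leafF-view t v)))

  φ-norm-promoted : promoted t v ≡ true → φ (norm t) v ≡ var (inj₂ v)
  φ-norm-promoted {v} p = trans (φF-norm n v) (leafF-andOr t andOr (andOr⇒no-fv andOr))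
    where andOr = proj₂ (promoted⇒inner p)

  no-chain : n ≤ℕ k → ¬ UnrankedChain t k v
  no-chain = no-long-chain bessy

  φF-stable : ∀ k k' v → ¬ UnrankedChain t k v → ¬ UnrankedChain t k' v → φF t k v ≡ φF t k' v
  φF-stable k k' v ¬c ¬c' with promoted t v in p | k | k'
  ... | false | k | k' =
    trans (φF-leaf t k (unpromoted⇒¬inner p)) (sym (φF-leaf t k' (unpromoted⇒¬inner p)))
  ... | true | zero | _ = ⊥-elim (¬c (stop (promoted⇒unranked t p)))
  ... | true | suc _ | zero = ⊥-elim (¬c' (stop (promoted⇒unranked t p)))
  ... | true | suc k | suc k' = begin
    φF t (suc k) v                             ≡⟨ φF-inner t k inner ⟩
    rhsOf (d t v) (map (φF t k) (succs t v))   ≡⟨ cong (rhsOf (d t v)) (map-cong-local (All.tabulate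
      λ m → φF-stable k k' _ (¬chain-succ t ur m ¬c) (¬chain-succ t ur m ¬c'))) ⟩
    rhsOf (d t v) (map (φF t k') (succs t v))  ≡⟨ φF-inner t k' inner ⟨
    φF t (suc k') v                            ∎
    where
    open ≡-Reasoning
    inner = promoted⇒inner p
    ur = proj₁ inner

  φ-promoted≡rhs : promoted t u ≡ true → φ t u ≡ rhs t u
  φ-promoted≡rhs {u} p = begin
    φF t n u                               ≡⟨ φF-stable n (suc n) u (no-chain ≤ℕ-refl) (no-chain (n≤1+n n)) ⟩
    φF t (suc n) u                         ≡⟨ φF-inner t n (promoted⇒inner p) ⟩
    rhsOf (d t u) (map (φ t) (succs t u))  ≡⟨ rhs-view t u ⟨
    rhs t u                                ∎
    where open ≡-Reasoning

  AgreeUnpromoted : Env n → Env n → Set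
  AgreeUnpromoted σ σ' = ∀ Y → promotedVar t Y ≡ false → σ Y ≡ σ' Y

  SolvesPromoted : Env n → Set
  SolvesPromoted σ = ∀ w → promoted t w ≡ true → σ (inj₂ w) ≡ ⟦ rhs (norm t) w ⟧F σ

  UnfoldsPromoted : Env n → Env n → Set
  UnfoldsPromoted σ σ' = ∀ w → promoted t w ≡ true → σ' (inj₂ w) ≡ ⟦ φ t w ⟧F σ

  Corresponds : Env n → Env n → Set
  Corresponds σ σ' = ∀ v → ⟦ φ t v ⟧F σ ≡ ⟦ φ (norm t) v ⟧F σ'

  rhs-corresponds : Corresponds σ σ' → ∀ u → ⟦ rhs t u ⟧F σ ≡ ⟦ rhs (norm t) u ⟧F σ'
  rhs-corresponds {σ} {σ'} φ≈ u = begin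
    ⟦ rhs t u ⟧F σ
      ≡⟨ cong (λ f → ⟦ f ⟧F σ) (rhs-view t u) ⟩
    ⟦ rhsOf (d t u) (map (φ t) (succs t u)) ⟧F σ
      ≡⟨ ⟦rhsOf⟧-cong (d t u) (⟦map⟧-cong _ λ {v} _ → φ≈ v) ⟩
    ⟦ rhsOf (d t u) (map (φ (norm t)) (succs t u)) ⟧F σ'
      ≡⟨ cong (λ f → ⟦ f ⟧F σ') (rhs-view (norm t) u) ⟨
    ⟦ rhs (norm t) u ⟧F σ'
      ∎
    where open ≡-Reasoning

  ⟦leafF⟧-agree : AgreeUnpromoted σ σ' → promoted t v ≡ false →
    ⟦ leafF t v ⟧F σ ≡ ⟦ leafF t v ⟧F σ'
  ⟦leafF⟧-agree {v = v} agree p rewrite leafF-view t v =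
    ⟦leafOf⟧-cong (d t v) (fv t v) (agree (inj₂ v) p) (λ X → agree (inj₁ X) refl)

  unpromoted-corresponds : AgreeUnpromoted σ σ' → promoted t v ≡ false → ∀ k →
    ⟦ φF t k v ⟧F σ ≡ ⟦ φ (norm t) v ⟧F σ'
  unpromoted-corresponds {σ} {σ'} {v} agree p k = begin
    ⟦ φF t k v ⟧F σ       ≡⟨ cong (λ f → ⟦ f ⟧F σ) (φF-leaf t k (unpromoted⇒¬inner p)) ⟩
    ⟦ leafF t v ⟧F σ      ≡⟨ ⟦leafF⟧-agree agree p ⟩
    ⟦ leafF t v ⟧F σ'     ≡⟨ cong (λ f → ⟦ f ⟧F σ') (φF-norm n v) ⟨
    ⟦ φ (norm t) v ⟧F σ'  ∎
    where open ≡-Reasoning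

  -- SolvesPromoted pins σ' down at the promoted vertices because their equations are acyclic:
  -- induction on the fuel k, which can only run out along an unranked chain of length k.
  module _ {σ σ'} (agree : AgreeUnpromoted σ σ') (solves : SolvesPromoted σ') where
    φF-corresponds : ∀ k v → ¬ UnrankedChain t k v →
      ⟦ φF t k v ⟧F σ ≡ ⟦ φ (norm t) v ⟧F σ'
    φF-corresponds k v ¬c with promoted t v in p | k
    ... | false | k = unpromoted-corresponds agree p k
    ... | true | zero = ⊥-elim (¬c (stop (promoted⇒unranked t p)))
    ... | true | suc k = begin
      ⟦ φF t (suc k) v ⟧F σ
        ≡⟨ cong (λ f → ⟦ f ⟧F σ) (φF-inner t k inner) ⟩
      ⟦ rhsOf (d t v) (map (φF t k) (succs t v)) ⟧F σ
        ≡⟨ ⟦rhsOf⟧-cong (d t v) (⟦map⟧-cong _ λ m → φF-corresponds k _ (¬chain-succ t ur m ¬c)) ⟩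
      ⟦ rhsOf (d t v) (map (φ (norm t)) (succs t v)) ⟧F σ'
        ≡⟨ cong (λ f → ⟦ f ⟧F σ') (rhs-view (norm t) v) ⟨
      ⟦ rhs (norm t) v ⟧F σ'
        ≡⟨ solves v p ⟨
      σ' (inj₂ v)
        ≡⟨ cong (λ f → ⟦ f ⟧F σ') (φ-norm-promoted p) ⟨
      ⟦ φ (norm t) v ⟧F σ'
        ∎
      where
      open ≡-Reasoning
      inner = promoted⇒inner p
      ur = proj₁ inner

  solved⇒corresponds : AgreeUnpromoted σ σ' → SolvesPromoted σ' → Corresponds σ σ'
  solved⇒corresponds agree solves v = φF-corresponds agree solves n v (no-chain ≤ℕ-refl)

  unfolded⇒corresponds : AgreeUnpromoted σ σ' → UnfoldsPromoted σ σ' → Corresponds σ σ'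
  unfolded⇒corresponds {σ' = σ'} agree unfolds v with promoted t v in p
  ... | false = unpromoted-corresponds agree p n
  ... | true = sym (trans (cong (λ f → ⟦ f ⟧F σ') (φ-norm-promoted p)) (unfolds v p))

  overridePromoted : Env n → (Fin n → Bool) → Env n
  overridePromoted σ g (inj₁ X) = σ (inj₁ X)
  overridePromoted σ g (inj₂ w) = if promoted t w then g w else σ (inj₂ w)

  overridePromoted-agree : ∀ σ g → AgreeUnpromoted (overridePromoted σ g) σ
  overridePromoted-agree σ g (inj₁ X) _ = refl
  overridePromoted-agree σ g (inj₂ w) p rewrite p = refl

  overridePromoted-promoted : ∀ σ g → promoted t w ≡ true → overridePromoted σ g (inj₂ w) ≡ g w
  overridePromoted-promoted σ g p rewrite p = refl

  module ZeroBlock (η : Env n) where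
    Zᵗ Zⁿ : List (Fin n)
    Zᵗ = zeroRanked t
    Zⁿ = zeroRanked (norm t)
    α β : Env n
    α = ⟦ νSystem (rhs t) Zᵗ ⟧B η
    β = ⟦ νSystem (rhs (norm t)) Zⁿ ⟧B η

    α-solution : u ∈ Zᵗ → α (inj₂ u) ≡ ⟦ rhs t u ⟧F α
    α-solution = νSystem-solution (rhs t) Zᵗ (zeroRanked-unique t) η

    β-solution : u ∈ Zⁿ → β (inj₂ u) ≡ ⟦ rhs (norm t) u ⟧F β
    β-solution = νSystem-solution (rhs (norm t)) Zⁿ (zeroRanked-unique (norm t)) η

    β-solves-promoted : SolvesPromoted β
    β-solves-promoted w p = β-solution (zeroRanked-norm-promoted t p)

    unbound-unpromoted : Unbound Y Zⁿ → promotedVar t Y ≡ false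
    unbound-unpromoted {inj₁ _} _ = refl
    unbound-unpromoted {inj₂ w} w∉ with promoted t w in p
    ... | true = ⊥-elim (w∉ (zeroRanked-norm-promoted t p) refl)
    ... | false = refl

    -- α, extended by the unfoldings of φ(t) at the promoted vertices, is a postfixpoint of the new block.
    unfold : Fin n → Bool
    unfold w = ⟦ φ t w ⟧F α
    α⁺ : Env n
    α⁺ = overridePromoted α unfold

    α⁺-corresponds : Corresponds α α⁺
    α⁺-corresponds = unfolded⇒corresponds (λ Y p → sym (overridePromoted-agree α unfold Y p))
      (λ w → overridePromoted-promoted α unfold)

    α⁺-unfolds : u ∈ Zⁿ → α⁺ (inj₂ u) ≡ ⟦ rhs t u ⟧F α
    α⁺-unfolds m with zeroRanked-norm⁻ t m
    ... | inj₁ old = trans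
      (overridePromoted-agree α unfold _ (ranked⇒unpromoted t (∈-zeroRanked⁻ t old)))
      (α-solution old)
    ... | inj₂ p = trans
      (overridePromoted-promoted α unfold p)
      (cong (λ f → ⟦ f ⟧F α) (φ-promoted≡rhs p))

    α⁺≤β : α⁺ ≤ᴱ β
    α⁺≤β = νSystem-greatest (rhs (norm t)) Zⁿ η
      (λ Y∉ → ≤-reflexive (trans (overridePromoted-agree α unfold _ (unbound-unpromoted Y∉))
                                 (νSystem-frame (rhs t) Zᵗ η (Y∉ ∘ zeroRanked-norm⁺ t))))
      (λ m → ≤-reflexive (trans (α⁺-unfolds m) (rhs-corresponds α⁺-corresponds _)))

    -- β, reset to η at the promoted vertices, is a postfixpoint of the old block.
    β⁻ : Env n
    β⁻ = overridePromoted β (η ∘ inj₂)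

    β⁻-corresponds : Corresponds β⁻ β
    β⁻-corresponds = solved⇒corresponds (overridePromoted-agree β (η ∘ inj₂)) β-solves-promoted

    β⁻-bounded : Unbound Y Zᵗ → β⁻ Y ≤ η Y
    β⁻-bounded {inj₁ X} _ = ≤-reflexive (νSystem-frame (rhs (norm t)) Zⁿ η λ _ ())
    β⁻-bounded {inj₂ w} w∉ with promoted t w in p
    ... | true = ≤-refl
    ... | false = ≤-reflexive (νSystem-frame (rhs (norm t)) Zⁿ η λ where
      m refl → case zeroRanked-norm⁻ t m of λ where
        (inj₁ old) → w∉ old refl
        (inj₂ p') → case trans (sym p) p' of λ ())

    β⁻-unfolds : u ∈ Zᵗ → β⁻ (inj₂ u) ≡ ⟦ rhs (norm t) u ⟧F β
    β⁻-unfolds m = trans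
      (overridePromoted-agree β (η ∘ inj₂) _ (ranked⇒unpromoted t (∈-zeroRanked⁻ t m)))
      (β-solution (zeroRanked-norm⁺ t m))

    β⁻≤α : β⁻ ≤ᴱ α
    β⁻≤α = νSystem-greatest (rhs t) Zᵗ η β⁻-bounded
      (λ m → ≤-reflexive (trans (β⁻-unfolds m) (sym (rhs-corresponds β⁻-corresponds _))))

    α≈β : AgreeUnpromoted α β
    α≈β Y p = ≤-antisym
      (≤-trans (≤-reflexive (sym (overridePromoted-agree α unfold Y p))) (α⁺≤β Y))
      (≤-trans (≤-reflexive (sym (overridePromoted-agree β (η ∘ inj₂) Y p))) (β⁻≤α Y))

  block-corresponds : ∀ ρ → Corresponds (⟦ νSystem (rhs t) (zeroRanked t) ⟧B ρ)
                                         (⟦ νSystem (rhs (norm t)) (zeroRanked (norm t)) ⟧B ρ)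
  block-corresponds ρ = solved⇒corresponds α≈β β-solves-promoted
    where open ZeroBlock ρ

  system-corresponds : ∀ P ρ → Corresponds (⟦ system t P ⟧B ρ) (⟦ system (norm t) P ⟧B ρ)
  system-corresponds [] = block-corresponds
  system-corresponds ((u , k) ∷ P) ρ =
    subst (λ b → Corresponds (⟦ system t P ⟧B (ρ [ inj₂ u ≔ fixσ s g ]))
                             (⟦ system (norm t) P ⟧B (ρ [ inj₂ u ≔ b ])))
      (fixσ-cong s λ b → rhs-corresponds (system-corresponds P (ρ [ inj₂ u ≔ b ])) u)
      (system-corresponds P _)
    where
    s = if oddᵇ k then μ else ν
    g : Bool → Bool
    g b = ⟦ rhs t u ⟧F (⟦ system t P ⟧B (ρ [ inj₂ u ≔ b ]))

lemma4p3 : ∀ {n : ℕ} (t : SG n) → BESsy t → ∀ (η : Env n) →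
    ⟦ φroot t ⟧F (⟦ BES t ⟧B η) ≡ ⟦ φroot (norm t) ⟧F (⟦ BES (norm t) ⟧B η)
lemma4p3 {n} t bessy η = begin
  ⟦ φroot t ⟧F (⟦ BES t ⟧B η)
    ≡⟨ cong (λ ℰ → ⟦ φroot t ⟧F (⟦ ℰ ⟧B η)) (BES-split t) ⟩
  ⟦ φroot t ⟧F (⟦ system t P ⟧B η)
    ≡⟨ system-corresponds t bessy P η (root t) ⟩
  ⟦ φroot (norm t) ⟧F (⟦ system (norm t) P ⟧B η)
    ≡⟨ cong (λ ℰ → ⟦ φroot (norm t) ⟧F (⟦ ℰ ⟧B η)) BES-norm-split ⟨
  ⟦ φroot (norm t) ⟧F (⟦ BES (norm t) ⟧B η)
    ∎
  where
  open ≡-Reasoning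
  P = sortByRank (positives (rankedVerts t (allFin n)))
  BES-norm-split : BES (norm t) ≡ system (norm t) P
  BES-norm-split = trans (BES-split (norm t))
    (cong (system (norm t) ∘ sortByRank) (positives-norm t (allFin n)))
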